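{- Let $(E,sim,ser)$ be a comtrace alphabet. A step sequence $u\in\mathbb{S}^*$ is in GMC-form if and only if it is canonical.
   Context: A comtrace alphabet is $(E,sim,ser)$ with $E$ finite, $sim\subseteq E\times E$ irreflexive and symmetric, $ser\subseteq sim$. Steps $\mathbb{S}$: nonempty $A\subseteq E$ with $(a,b)\in sim$ for all distinct $a,b\in A$. The comtrace congruence $\equiv$ on $\mathbb{S}^*$ is the reflexive symmetric transitive closure of the pairs $(wAz,wBCz)$ with $w,z\in\mathbb{S}^*$, $A,B,C\in\mathbb{S}$, $A=B\cup C$, $B\times C\subseteq ser$. A step sequence $u=A_1\dots A_k$ is in GMC-form iff for each $i=1,\dots,k$ and all $B\in\mathbb{S}$, $y\in\mathbb{S}^*$: $By\equiv A_i\dots A_k\Rightarrow|B|\le|A_i|$. The forward dependency $\mathbb{FD}\subseteq\mathbb{S}\times\mathbb{S}$ consists of pairs $(A,B)$ for which there is $C\in\mathbb{S}$ with $C\subseteq B$, $A\times C\subseteq ser$ and $C\times(B\setminus C)\subseteq ser$. A step sequence $A_1\dots A_k$ is canonical iff $(A_i,A_{i+1})\notin\mathbb{FD}$ for all $1\le i<k$. -}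

module Defs where

open import Data.Nat using (ℕ; _≤_)
open import Data.Fin using (Fin)
open import Data.Fin.Subset using (Subset; _∈_; _⊆_; _∪_; _─_; ∣_∣; Nonempty)
open import Data.List using (List; []; _∷_; _++_)
open import Data.List.Relation.Unary.All using (All)
open import Data.Product using (_×_; Σ)
open import Data.Unit using (⊤)
open import Data.Empty using (⊥)
open import Relation.Nullary using (¬_)
open import Relation.Binary.PropositionalEquality using (_≡_)
open import Relation.Binary.Construct.Closure.Equivalence using (EqClosure)

record ComtraceAlphabet : Set₁ where
  field
    size      : ℕ
    sim       : Fin size → Fin size → Set
    ser       : Fin size → Fin size → Set
    sim-irrefl : ∀ a → ¬ sim a a
    sim-sym   : ∀ a b → sim a b → sim b a
    ser⊆sim   : ∀ a b → ser a b → sim a b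

module _ (Σa : ComtraceAlphabet) where
  open ComtraceAlphabet Σa

  E : Set
  E = Fin size

  ProdIn : Subset size → Subset size → (E → E → Set) → Set
  ProdIn X Y R = ∀ a b → a ∈ X → b ∈ Y → R a b

  IsStep : Subset size → Set
  IsStep A = Nonempty A × (∀ a b → a ∈ A → b ∈ A → ¬ a ≡ b → sim a b)

  IsStepSeq : List (Subset size) → Set
  IsStepSeq = All IsStep

  data CGen : List (Subset size) → List (Subset size) → Set where
    split : ∀ (w z : List (Subset size)) (A B C : Subset size) →
            IsStepSeq w → IsStepSeq z →
            IsStep A → IsStep B → IsStep C →
            A ≡ B ∪ C → ProdIn B C ser →
            CGen (w ++ A ∷ z) (w ++ B ∷ C ∷ z)

  _≡c_ : List (Subset size) → List (Subset size) → Set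
  _≡c_ = EqClosure CGen

  GMC : List (Subset size) → Set
  GMC [] = ⊤
  GMC (A ∷ v) =
    (∀ (B : Subset size) (y : List (Subset size)) →
       IsStep B → IsStepSeq y → (B ∷ y) ≡c (A ∷ v) → ∣ B ∣ ≤ ∣ A ∣)
    × GMC v

  FD : Subset size → Subset size → Set
  FD A B = Σ (Subset size) λ C →
    IsStep C × (C ⊆ B) × ProdIn A C ser × ProdIn C (B ─ C) ser

  Canonical : List (Subset size) → Set
  Canonical [] = ⊤
  Canonical (A ∷ []) = ⊤
  Canonical (A ∷ B ∷ v) = ¬ FD A B × Canonical (B ∷ v)

module Submission where

open import Defs
open import Data.Fin.Subset using (Subset)
open import Data.List using (List)
open import Data.Product using (_×_)

open import Data.Bool using (if_then_else_)
open import Data.Empty using (⊥; ⊥-elim)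
open import Data.Fin using (Fin) renaming (zero to fzero; suc to fsuc)
open import Data.Fin.Subset using (_∈_; _∉_; _⊆_; _∪_; _─_; ∣_∣; Nonempty; inside; outside)
open import Data.Fin.Subset.Properties
  using (_∈?_; nonempty?; p⊆p∪q; q⊆p∪q; x∈p∪q⁻; ⊆-antisym; p⊆q⇒∣p∣≤∣q∣; p⊂q⇒∣p∣<∣q∣;
         x∈p∧x∉q⇒x∈p─q; p─q⊆p)
open import Data.List using ([]; _∷_; _++_)
open import Data.List.Relation.Unary.All using ([]; _∷_)
open import Data.Nat using (ℕ; zero; suc; _≤_; _<_; z≤n; s≤s)
open import Data.Nat.Properties using (≤-refl; ≤-trans; <⇒≤; <-≤-trans; <⇒≱; n≮0)
open import Data.Product using (Σ; _,_; proj₁; proj₂)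
open import Data.Sum using (_⊎_; inj₁; inj₂)
open import Data.Unit using (tt)
open import Data.Vec using ([]; _∷_; here; there)
open import Function using (_∘_)
open import Relation.Nullary using (¬_; Dec; yes; no; does; contradiction)
open import Relation.Nullary.Decidable using (decidable-stable; ¬¬-excluded-middle; ¬?; _×-dec_)
open import Relation.Binary.PropositionalEquality using (_≡_; refl; sym; cong; subst)
open import Relation.Binary.Construct.Closure.ReflexiveTransitive using (Star; ε; _◅_; _◅◅_; gmap)
open import Relation.Binary.Construct.Closure.Symmetric using (fwd; bwd)

-- For a step sequence u call an occurrence (i , x) of the event x
-- in the i-th step of u *blocked* if it is reachable, along a chain of
-- "must not come later than" edges, from the target of a "must come strictly
-- later than" edge.  An event *leads* u if it has an unblocked occurrence
-- (intuitively: it may be executed first in some sequence equivalent to u).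
--   (1) leadership is invariant under the comtrace congruence, because every
--       generating rewrite A ↦ B C relabels positions monotonically;
--   (2) every event of the first step leads;
--   (3) in a canonical sequence an unblocked occurrence after the first step
--       would yield a forward dependency, so only first-step events lead.
-- Hence for canonical A v and B y ≡ A v we get B ⊆ A, so |B| ≤ |A| (GMC-form).
-- Conversely, a forward dependency (A , B) witnessed by C lets us rewrite
-- A B v into (A ∪ C) (B ─ C) v, whose first step is strictly larger than A.

-- Double-negation shift over a finite domain: finitely many classically valid
-- facts may be assumed together when proving a negative goal.
¬¬-∀-Fin : ∀ n {Q : Fin n → Set} → (∀ i → ¬ ¬ Q i) → ¬ ¬ (∀ i → Q i)
¬¬-∀-Fin zero    h k = k (λ ())
¬¬-∀-Fin (suc n) h k =
  h fzero λ q₀ → ¬¬-∀-Fin n (λ i → h (fsuc i)) λ qs →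
  k λ { fzero → q₀ ; (fsuc i) → qs i }

comprehension : ∀ {n} {P : Fin n → Set} → (∀ i → Dec (P i)) → Subset n
comprehension {zero}  d = []
comprehension {suc n} d = does (d fzero) ∷ comprehension (λ i → d (fsuc i))

∈-comprehension⁺ : ∀ {n} {P : Fin n → Set} (d : ∀ i → Dec (P i)) {i} →
                   P i → i ∈ comprehension d
∈-comprehension⁺ d {fzero} p with d fzero
... | yes _ = here
... | no ¬p = contradiction p ¬p
∈-comprehension⁺ d {fsuc i} p = there (∈-comprehension⁺ (λ j → d (fsuc j)) p)

∈-comprehension⁻ : ∀ {n} {P : Fin n → Set} (d : ∀ i → Dec (P i)) {i} →
                   i ∈ comprehension d → P i
∈-comprehension⁻ d {fzero} m with d fzero | m
... | yes p | _ = p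
... | no _  | ()
∈-comprehension⁻ d {fsuc i} (there m) = ∈-comprehension⁻ (λ j → d (fsuc j)) m

x∈p─q⇒x∉q : ∀ {n} (p q : Subset n) {x} → x ∈ p ─ q → x ∉ q
x∈p─q⇒x∉q (s ∷ p) (outside ∷ q) here      ()
x∈p─q⇒x∉q (s ∷ p) (inside  ∷ q) ()        here
x∈p─q⇒x∉q (s ∷ p) (t ∷ q)       (there m) (there m′) = x∈p─q⇒x∉q p q m m′

⊆⇒≡∪─ : ∀ {n} {p q : Subset n} → p ⊆ q → q ≡ p ∪ (q ─ p)
⊆⇒≡∪─ {p = p} {q} p⊆q = ⊆-antisym into (λ m → outOf (x∈p∪q⁻ p (q ─ p) m))
  where
  into : q ⊆ p ∪ (q ─ p)
  into {x} x∈q with x ∈? p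
  ... | yes x∈p = p⊆p∪q (q ─ p) x∈p
  ... | no  x∉p = q⊆p∪q p (q ─ p) (x∈p∧x∉q⇒x∈p─q x∈q x∉p)
  outOf : ∀ {x} → x ∈ p ⊎ x ∈ q ─ p → x ∈ q
  outOf (inj₁ x∈p)   = p⊆q x∈p
  outOf (inj₂ x∈q─p) = p─q⊆p q p x∈q─p

module Comtraces (Σa : ComtraceAlphabet) where
  open ComtraceAlphabet Σa

  Step : Set
  Step = Subset size

  Ev : Set
  Ev = Fin size

  _∈at_of_ : Ev → ℕ → List Step → Set
  x ∈at i     of []      = ⊥
  x ∈at zero  of (A ∷ u) = x ∈ A
  x ∈at suc i of (A ∷ u) = x ∈at i of u

  Occ : Set
  Occ = ℕ × Ev

  -- (i , x) weakly precedes (j , y): x is not after y and y cannot be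
  -- serialised before x, so no equivalent sequence puts x after y.
  WeakBefore : List Step → Occ → Occ → Set
  WeakBefore u (i , x) (j , y) = x ∈at i of u × y ∈at j of u × i ≤ j × ¬ ser y x

  -- (i , x) strictly precedes (j , y): x is before y and cannot be executed
  -- simultaneously with y, so every equivalent sequence keeps x before y.
  StrictBefore : List Step → Occ → Occ → Set
  StrictBefore u (i , x) (j , y) = x ∈at i of u × y ∈at j of u × i < j × ¬ ser x y

  Before : List Step → Occ → Occ → Set
  Before u a b = WeakBefore u a b ⊎ StrictBefore u a b

  -- An occurrence is blocked if it is reached, along Before-edges, from the
  -- target of a StrictBefore-edge; blocked occurrences can never come first.
  Blocked : List Step → Occ → Set
  Blocked u c = Σ Occ λ a → Σ Occ λ b → StrictBefore u a b × Star (Before u) b c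

  Leads : List Step → Ev → Set
  Leads u x = Σ ℕ λ i → x ∈at i of u × ¬ Blocked u (i , x)

  blocked-map : ∀ {u v} (F : Occ → Occ) →
                (∀ {a b} → WeakBefore u a b → WeakBefore v (F a) (F b)) →
                (∀ {a b} → StrictBefore u a b → StrictBefore v (F a) (F b)) →
                ∀ {c} → Blocked u c → Blocked v (F c)
  blocked-map {u} {v} F weak strict (a , b , a≺b , b→c) =
    F a , F b , strict a≺b , gmap F edge b→c
    where
    edge : ∀ {a b} → Before u a b → Before v (F a) (F b)
    edge (inj₁ w) = inj₁ (weak w)
    edge (inj₂ s) = inj₂ (strict s)

  blocked-extend : ∀ {u b c} → Blocked u b → Before u b c → Blocked u c
  blocked-extend (a , a′ , a≺a′ , a′→b) b→c = a , a′ , a≺a′ , a′→b ◅◅ (b→c ◅ ε)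

  before*-mono : ∀ u {a b} → Star (Before u) a b → proj₁ a ≤ proj₁ b
  before*-mono u ε                              = ≤-refl
  before*-mono u (inj₁ (_ , _ , i≤j , _) ◅ p) = ≤-trans i≤j (before*-mono u p)
  before*-mono u (inj₂ (_ , _ , i<j , _) ◅ p) = ≤-trans (<⇒≤ i<j) (before*-mono u p)

  record Relabelling (u v : List Step) : Set where
    field
      pos      : Ev → ℕ → ℕ
      pos-∈    : ∀ {i x} → x ∈at i of u → x ∈at pos x i of v
      pos-≤    : ∀ {i j x y} → x ∈at i of u → y ∈at j of u →
                 i ≤ j → ¬ ser y x → pos x i ≤ pos y j
      pos-<    : ∀ {i j x y} → x ∈at i of u → y ∈at j of u →
                 i < j → ¬ ser x y → pos x i < pos y j
      back     : Ev → ℕ → ℕ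
      back-∈   : ∀ {i x} → x ∈at i of v → x ∈at back x i of u
      pos-back : ∀ {i x} → x ∈at i of v → pos x (back x i) ≡ i

  -- A relabelling reflects leadership: an unblocked occurrence in v pulls back
  -- to one in u, since a blocking chain in u would be pushed forward to v.
  leads-relabel : ∀ {u v} → Relabelling u v → ∀ {x} → Leads v x → Leads u x
  leads-relabel {u} {v} r {x} (i , x∈ , free) = back x i , back-∈ x∈ , λ bl →
      free (subst (λ k → Blocked v (k , x)) (pos-back x∈)
                  (blocked-map {u} {v} relabel weak strict bl))
    where
    open Relabelling r
    relabel : Occ → Occ
    relabel (j , y) = pos y j , y
    weak : ∀ {a b} → WeakBefore u a b → WeakBefore v (relabel a) (relabel b)
    weak {_ , _} {_ , _} (mx , my , i≤j , ns) = pos-∈ mx , pos-∈ my , pos-≤ mx my i≤j ns , ns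
    strict : ∀ {a b} → StrictBefore u a b → StrictBefore v (relabel a) (relabel b)
    strict {_ , _} {_ , _} (mx , my , i<j , ns) = pos-∈ mx , pos-∈ my , pos-< mx my i<j ns , ns

  relabel-cons : ∀ {u v} W → Relabelling u v → Relabelling (W ∷ u) (W ∷ v)
  relabel-cons {u} {v} W r = record
    { pos = shift pos ; pos-∈ = λ {i} {x} → pos-∈′ {i} {x} ; pos-≤ = pos-≤′ ; pos-< = pos-<′
    ; back = shift back ; back-∈ = λ {i} {x} → back-∈′ {i} {x}
    ; pos-back = λ {i} {x} → pos-back′ {i} {x} }
    where
    open Relabelling r
    shift : (Ev → ℕ → ℕ) → Ev → ℕ → ℕ
    shift f x zero    = zero
    shift f x (suc i) = suc (f x i)
    pos-∈′ : ∀ {i x} → x ∈at i of (W ∷ u) → x ∈at shift pos x i of (W ∷ v)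
    pos-∈′ {zero}  m = m
    pos-∈′ {suc i} m = pos-∈ m
    pos-≤′ : ∀ {i j x y} → x ∈at i of (W ∷ u) → y ∈at j of (W ∷ u) →
             i ≤ j → ¬ ser y x → shift pos x i ≤ shift pos y j
    pos-≤′ {zero}          _  _  _         _  = z≤n
    pos-≤′ {suc i} {suc j} mx my (s≤s i≤j) ns = s≤s (pos-≤ mx my i≤j ns)
    pos-<′ : ∀ {i j x y} → x ∈at i of (W ∷ u) → y ∈at j of (W ∷ u) →
             i < j → ¬ ser x y → shift pos x i < shift pos y j
    pos-<′ {zero}  {suc j} _  _  _         _  = s≤s z≤n
    pos-<′ {suc i} {suc j} mx my (s≤s i<j) ns = s≤s (pos-< mx my i<j ns)
    back-∈′ : ∀ {i x} → x ∈at i of (W ∷ v) → x ∈at shift back x i of (W ∷ u)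
    back-∈′ {zero}  m = m
    back-∈′ {suc i} m = back-∈ m
    pos-back′ : ∀ {i x} → x ∈at i of (W ∷ v) → shift pos x (shift back x i) ≡ i
    pos-back′ {zero}  _ = refl
    pos-back′ {suc i} m = cong suc (pos-back m)

  relabel-prefix : ∀ {u v} w → Relabelling u v → Relabelling (w ++ u) (w ++ v)
  relabel-prefix []      r = r
  relabel-prefix (W ∷ w) r = relabel-cons W (relabel-prefix w r)

  module SplitFirst {A B C : Step} (z : List Step)
                    (A≡B∪C : A ≡ B ∪ C) (B×C⊆ser : ProdIn Σa B C ser) where

    B⊆A : B ⊆ A
    B⊆A m = subst (_ ∈_) (sym A≡B∪C) (p⊆p∪q C m)

    C⊆A : C ⊆ A
    C⊆A m = subst (_ ∈_) (sym A≡B∪C) (q⊆p∪q B C m)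

    A⊆B∪C : ∀ {x} → x ∈ A → x ∈ B ⊎ x ∈ C
    A⊆B∪C m = x∈p∪q⁻ B C (subst (_ ∈_) A≡B∪C m)

    expand : Ev → ℕ → ℕ
    expand x zero    = if does (x ∈? B) then 0 else 1
    expand x (suc i) = suc (suc i)

    collapse : ℕ → ℕ
    collapse zero          = zero
    collapse (suc zero)    = zero
    collapse (suc (suc i)) = suc i

    expand₀≤1 : ∀ x → expand x zero ≤ 1
    expand₀≤1 x with x ∈? B
    ... | yes _ = z≤n
    ... | no  _ = s≤s z≤n

    expand-∈ : ∀ {i x} → x ∈at i of (A ∷ z) → x ∈at expand x i of (B ∷ C ∷ z)
    expand-∈ {zero} {x} m with x ∈? B | A⊆B∪C m
    ... | yes x∈B | _       = x∈B
    ... | no  x∉B | inj₁ x∈B = contradiction x∈B x∉B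
    ... | no  _   | inj₂ x∈C = x∈C
    expand-∈ {suc i} m = m

    expand-≤ : ∀ {i j x y} → x ∈at i of (A ∷ z) → y ∈at j of (A ∷ z) →
               i ≤ j → ¬ ser y x → expand x i ≤ expand y j
    expand-≤ {zero} {zero} {x} {y} mx _ _ ns with x ∈? B | y ∈? B | A⊆B∪C mx
    ... | yes _   | _       | _        = z≤n
    ... | no  _   | no  _   | _        = s≤s z≤n
    ... | no  x∉B | yes _   | inj₁ x∈B = contradiction x∈B x∉B
    ... | no  _   | yes y∈B | inj₂ x∈C = contradiction (B×C⊆ser _ _ y∈B x∈C) ns
    expand-≤ {zero}  {suc j} {x} _ _ _ _ = ≤-trans (expand₀≤1 x) (s≤s z≤n)
    expand-≤ {suc i} {suc j} _ _ (s≤s i≤j) _ = s≤s (s≤s i≤j)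

    expand-< : ∀ {i j x y} → i < j → expand x i < expand y j
    expand-< {zero}  {suc j} {x} _ = s≤s (≤-trans (expand₀≤1 x) (s≤s z≤n))
    expand-< {suc i} {suc j} (s≤s i<j) = s≤s (s≤s i<j)

    collapse-∈ : ∀ {i x} → x ∈at i of (B ∷ C ∷ z) → x ∈at collapse i of (A ∷ z)
    collapse-∈ {zero}          m = B⊆A m
    collapse-∈ {suc zero}      m = C⊆A m
    collapse-∈ {suc (suc i)}   m = m

    collapse-≤ : ∀ {i j} → i ≤ j → collapse i ≤ collapse j
    collapse-≤ {zero}                        _               = z≤n
    collapse-≤ {suc zero}    {suc j}         _               = z≤n
    collapse-≤ {suc (suc i)} {suc (suc j)} (s≤s (s≤s i≤j)) = s≤s i≤j

    collapse-< : ∀ {i j x y} → x ∈at i of (B ∷ C ∷ z) → y ∈at j of (B ∷ C ∷ z) →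
                 i < j → ¬ ser x y → collapse i < collapse j
    collapse-< {zero}     {suc zero}    x∈B y∈C _ ns = contradiction (B×C⊆ser _ _ x∈B y∈C) ns
    collapse-< {zero}     {suc (suc j)} _ _ _ _ = s≤s z≤n
    collapse-< {suc zero} {suc (suc j)} _ _ _ _ = s≤s z≤n
    collapse-< {suc zero} {suc zero}    _ _ (s≤s ()) _
    collapse-< {suc (suc i)} {suc (suc j)} _ _ (s≤s (s≤s i<j)) _ = s≤s i<j

    collapse∘expand : ∀ x i → collapse (expand x i) ≡ i
    collapse∘expand x zero with x ∈? B
    ... | yes _ = refl
    ... | no  _ = refl
    collapse∘expand x (suc i) = refl

    expand∘collapse : ∀ {i x} → x ∈at i of (B ∷ C ∷ z) → expand x (collapse i) ≡ i
    expand∘collapse {zero} {x} x∈B with x ∈? B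
    ... | yes _   = refl
    ... | no  x∉B = contradiction x∈B x∉B
    expand∘collapse {suc zero} {x} x∈C with x ∈? B
    ... | yes x∈B = contradiction (B×C⊆ser _ _ x∈B x∈C) (sim-irrefl x ∘ ser⊆sim x x)
    ... | no  _   = refl
    expand∘collapse {suc (suc i)} _ = refl

    merge→split : Relabelling (A ∷ z) (B ∷ C ∷ z)
    merge→split = record
      { pos = expand ; pos-∈ = λ {i} {x} → expand-∈ {i} {x}
      ; pos-≤ = expand-≤ ; pos-< = λ _ _ i<j _ → expand-< i<j
      ; back = λ _ → collapse ; back-∈ = λ {i} {x} → collapse-∈ {i} {x}
      ; pos-back = λ {i} {x} → expand∘collapse {i} {x} }

    split→merge : Relabelling (B ∷ C ∷ z) (A ∷ z)
    split→merge = record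
      { pos = λ _ → collapse ; pos-∈ = λ {i} {x} → collapse-∈ {i} {x}
      ; pos-≤ = λ _ _ i≤j _ → collapse-≤ i≤j ; pos-< = collapse-<
      ; back = expand ; back-∈ = λ {i} {x} → expand-∈ {i} {x}
      ; pos-back = λ {i} {x} _ → collapse∘expand x i }

  leads-CGen : ∀ {u v} → CGen Σa u v → ∀ {x} → Leads u x → Leads v x
  leads-CGen (split w z _ _ _ _ _ _ _ _ A≡B∪C B×C⊆ser) =
    leads-relabel (relabel-prefix w (SplitFirst.split→merge z A≡B∪C B×C⊆ser))

  leads-CGen⁻ : ∀ {u v} → CGen Σa u v → ∀ {x} → Leads v x → Leads u x
  leads-CGen⁻ (split w z _ _ _ _ _ _ _ _ A≡B∪C B×C⊆ser) =
    leads-relabel (relabel-prefix w (SplitFirst.merge→split z A≡B∪C B×C⊆ser))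

  leads-≡c : ∀ {u v} → _≡c_ Σa u v → ∀ {x} → Leads u x → Leads v x
  leads-≡c ε           ℓ = ℓ
  leads-≡c (fwd g ◅ p) ℓ = leads-≡c p (leads-CGen g ℓ)
  leads-≡c (bwd g ◅ p) ℓ = leads-≡c p (leads-CGen⁻ g ℓ)

  -- Every event of the first step leads: a blocking chain ending at position 0
  -- would have to start with a strict edge into a position ≤ 0.
  head-leads : ∀ {B y x} → x ∈ B → Leads (B ∷ y) x
  head-leads {B} {y} x∈B = 0 , x∈B , λ { ((i , _) , (j , _) , (_ , _ , i<j , _) , b→c) →
    n≮0 (<-≤-trans i<j (before*-mono (B ∷ y) b→c)) }

  blocked-shift : ∀ A {v i x} → Blocked v (i , x) → Blocked (A ∷ v) (suc i , x)
  blocked-shift A {v} = blocked-map {v} {A ∷ v} shift weak strict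
    where
    shift : Occ → Occ
    shift (j , y) = suc j , y
    weak : ∀ {a b} → WeakBefore v a b → WeakBefore (A ∷ v) (shift a) (shift b)
    weak {_ , _} {_ , _} (mx , my , i≤j , ns) = mx , my , s≤s i≤j , ns
    strict : ∀ {a b} → StrictBefore v a b → StrictBefore (A ∷ v) (shift a) (shift b)
    strict {_ , _} {_ , _} (mx , my , i<j , ns) = mx , my , s≤s i<j , ns

  -- If the second step A′ of A A′ v has an unblocked occurrence, its unblocked
  -- events C form a forward dependency (A , A′): an a ∈ A not ser-before some
  -- c ∈ C would block c, and a c ∈ C not ser-before some blocked e ∈ A′ ─ C
  -- would inherit e's blocking.  (Decidability is needed to form C.)
  unblocked⇒FD : ∀ A {A′} v → IsStep Σa A′ →
                 (∀ c → Dec (Blocked (A ∷ A′ ∷ v) (1 , c))) → (∀ a b → Dec (ser a b)) →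
                 ∀ {x} → x ∈ A′ → ¬ Blocked (A ∷ A′ ∷ v) (1 , x) → FD Σa A A′
  unblocked⇒FD A {A′} v (_ , A′-sim) blocked? ser? {x} x∈A′ x-free =
    C , ((x , ∈-comprehension⁺ free? (x∈A′ , x-free)) , C-sim) , C⊆A′ , A×C⊆ser , C×A′─C⊆ser
    where
    Free : Ev → Set
    Free c = c ∈ A′ × ¬ Blocked (A ∷ A′ ∷ v) (1 , c)
    free? : ∀ c → Dec (Free c)
    free? c = (c ∈? A′) ×-dec ¬? (blocked? c)
    C : Step
    C = comprehension free?
    C⊆A′ : C ⊆ A′
    C⊆A′ m = proj₁ (∈-comprehension⁻ free? m)
    C-sim : ∀ a b → a ∈ C → b ∈ C → ¬ a ≡ b → sim a b
    C-sim a b a∈C b∈C = A′-sim a b (C⊆A′ a∈C) (C⊆A′ b∈C)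
    A×C⊆ser : ProdIn Σa A C ser
    A×C⊆ser a c a∈A c∈C = decidable-stable (ser? a c) λ ¬ser →
      proj₂ (∈-comprehension⁻ free? c∈C)
        ((0 , a) , (1 , c) , (a∈A , C⊆A′ c∈C , s≤s z≤n , ¬ser) , ε)
    C×A′─C⊆ser : ProdIn Σa C (A′ ─ C) ser
    C×A′─C⊆ser c e c∈C e∈A′─C = decidable-stable (ser? c e) λ ¬ser →
      e-not-free (e∈A′ , λ e-blocked → proj₂ (∈-comprehension⁻ free? c∈C)
        (blocked-extend {A ∷ A′ ∷ v} e-blocked (inj₁ (e∈A′ , C⊆A′ c∈C , ≤-refl , ¬ser))))
      where
      e∈A′ : e ∈ A′
      e∈A′ = p─q⊆p A′ C e∈A′─C
      e-not-free : ¬ Free e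
      e-not-free = x∈p─q⇒x∉q A′ C e∈A′─C ∘ ∈-comprehension⁺ free?

  canonical⇒blocked : ∀ u → IsStepSeq Σa u → Canonical Σa u →
                      ∀ {i x} → x ∈at suc i of u → ¬ ¬ Blocked u (suc i , x)
  canonical⇒blocked [] _ _ ()
  canonical⇒blocked (A ∷ []) _ _ ()
  canonical⇒blocked (A ∷ A′ ∷ v) (_ ∷ A′-step ∷ _) (¬fd , _) {zero} x∈A′ x-free =
    ¬¬-∀-Fin size (λ _ → ¬¬-excluded-middle) λ blocked? →
    ¬¬-∀-Fin size (λ _ → ¬¬-∀-Fin size (λ _ → ¬¬-excluded-middle)) λ ser? →
    ¬fd (unblocked⇒FD A v A′-step blocked? ser? x∈A′ x-free)
  canonical⇒blocked (A ∷ A′ ∷ v) (_ ∷ steps) (_ , canon) {suc i} x∈ x-free =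
    canonical⇒blocked (A′ ∷ v) steps canon x∈ (x-free ∘ blocked-shift A)

  canonical-leads⇒head : ∀ A v → IsStepSeq Σa (A ∷ v) → Canonical Σa (A ∷ v) →
                         ∀ {x} → Leads (A ∷ v) x → x ∈ A
  canonical-leads⇒head A v _     _     (zero  , x∈A , _)    = x∈A
  canonical-leads⇒head A v steps canon (suc i , x∈  , free) =
    ⊥-elim (canonical⇒blocked (A ∷ v) steps canon x∈ free)

  canonical-tail : ∀ A v → Canonical Σa (A ∷ v) → Canonical Σa v
  canonical-tail A []      _           = tt
  canonical-tail A (B ∷ v) (_ , canon) = canon

  canonical⇒GMC : ∀ u → IsStepSeq Σa u → Canonical Σa u → GMC Σa u
  canonical⇒GMC []      _               _     = tt
  canonical⇒GMC (A ∷ v) steps@(_ ∷ vs) canon =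
    (λ B y _ _ By≡Av → p⊆q⇒∣p∣≤∣q∣ λ x∈B →
       canonical-leads⇒head A v steps canon (leads-≡c By≡Av (head-leads x∈B))) ,
    canonical⇒GMC v vs (canonical-tail A v canon)

  ∪-step : ∀ {A C} → IsStep Σa A → IsStep Σa C → ProdIn Σa A C ser → IsStep Σa (A ∪ C)
  ∪-step {A} {C} ((a , a∈A) , A-sim) (_ , C-sim) A×C⊆ser = (a , p⊆p∪q C a∈A) , pairwise
    where
    pairwise : ∀ a b → a ∈ A ∪ C → b ∈ A ∪ C → ¬ a ≡ b → sim a b
    pairwise a b a∈ b∈ a≢b with x∈p∪q⁻ A C a∈ | x∈p∪q⁻ A C b∈
    ... | inj₁ a∈A | inj₁ b∈A = A-sim a b a∈A b∈A a≢b
    ... | inj₂ a∈C | inj₂ b∈C = C-sim a b a∈C b∈C a≢b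
    ... | inj₁ a∈A | inj₂ b∈C = ser⊆sim a b (A×C⊆ser a b a∈A b∈C)
    ... | inj₂ a∈C | inj₁ b∈A = sim-sym b a (ser⊆sim b a (A×C⊆ser b a b∈A a∈C))

  -- ser is irreflexive, so a nonempty C with A × C ⊆ ser is disjoint from A
  -- and strictly enlarges it.
  ∪-ser-grows : ∀ {A C} → Nonempty C → ProdIn Σa A C ser → ∣ A ∣ < ∣ A ∪ C ∣
  ∪-ser-grows {A} {C} (c , c∈C) A×C⊆ser = p⊂q⇒∣p∣<∣q∣ (p⊆p∪q C , c , q⊆p∪q A C c∈C , c∉A)
    where
    c∉A : c ∉ A
    c∉A c∈A = sim-irrefl c (ser⊆sim c c (A×C⊆ser c c c∈A c∈C))

  -- A forward dependency (A , B) witnessed by C lets A B v be rewritten into a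
  -- sequence with first step A ∪ C: split A ∪ C into A C, then merge C with
  -- the rest B ─ C of B (if that rest is empty, then already C = B).
  FD⇒rewrite : ∀ {A B C} v → IsStep Σa A → IsStep Σa B → IsStepSeq Σa v →
               IsStep Σa C → C ⊆ B → ProdIn Σa A C ser → ProdIn Σa C (B ─ C) ser →
               Σ (List Step) λ y → IsStepSeq Σa y × _≡c_ Σa ((A ∪ C) ∷ y) (A ∷ B ∷ v)
  FD⇒rewrite {A} {B} {C} v A-step B-step vs C-step C⊆B A×C⊆ser C×B─C⊆ser
    with nonempty? (B ─ C)
  ... | yes ne = (B ─ C) ∷ v , B─C-step ∷ vs ,
      fwd (split-A∪C (B─C-step ∷ vs))
    ◅ bwd (split (A ∷ []) v B C (B ─ C) (A-step ∷ []) vs B-step C-step B─C-step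
                 (⊆⇒≡∪─ C⊆B) C×B─C⊆ser)
    ◅ ε
    where
    B─C-step : IsStep Σa (B ─ C)
    B─C-step = ne , λ a b a∈ b∈ → proj₂ B-step a b (p─q⊆p B C a∈) (p─q⊆p B C b∈)
    split-A∪C : ∀ {z} → IsStepSeq Σa z → CGen Σa ((A ∪ C) ∷ z) (A ∷ C ∷ z)
    split-A∪C {z} zs = split [] z (A ∪ C) A C [] zs (∪-step A-step C-step A×C⊆ser)
                             A-step C-step refl A×C⊆ser
  ... | no empty = v , vs ,
      subst (λ X → _≡c_ Σa ((A ∪ C) ∷ v) (A ∷ X ∷ v)) C≡B
        (fwd (split [] v (A ∪ C) A C [] vs (∪-step A-step C-step A×C⊆ser)
                    A-step C-step refl A×C⊆ser) ◅ ε)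
    where
    B⊆C : B ⊆ C
    B⊆C {x} x∈B with x ∈? C
    ... | yes x∈C = x∈C
    ... | no  x∉C = contradiction (x , x∈p∧x∉q⇒x∈p─q x∈B x∉C) empty
    C≡B : C ≡ B
    C≡B = ⊆-antisym C⊆B B⊆C

  GMC⇒canonical : ∀ u → IsStepSeq Σa u → GMC Σa u → Canonical Σa u
  GMC⇒canonical []          _                      _                   = tt
  GMC⇒canonical (A ∷ [])    _                      _                   = tt
  GMC⇒canonical (A ∷ B ∷ v) (A-step ∷ B-step ∷ vs) (first-max , gmc) =
    ¬FD , GMC⇒canonical (B ∷ v) (B-step ∷ vs) gmc
    where
    ¬FD : ¬ FD Σa A B
    ¬FD (C , C-step , C⊆B , A×C⊆ser , C×B─C⊆ser)
      with FD⇒rewrite v A-step B-step vs C-step C⊆B A×C⊆ser C×B─C⊆ser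
    ... | y , ys , A∪C∷y≡ABv =
      <⇒≱ (∪-ser-grows (proj₁ C-step) A×C⊆ser)
          (first-max (A ∪ C) y (∪-step A-step C-step A×C⊆ser) ys A∪C∷y≡ABv)

theorem8p2 : (Σa : ComtraceAlphabet) (u : List (Subset (ComtraceAlphabet.size Σa))) →
    IsStepSeq Σa u →
    (GMC Σa u → Canonical Σa u) × (Canonical Σa u → GMC Σa u)
theorem8p2 Σa u steps = GMC⇒canonical u steps , canonical⇒GMC u steps
  where open Comtraces Σa
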